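{- (1) The relation $\widetilde{\to_r^*}$ on sets of resource terms is reflexive and transitive. (2) $(\widetilde{\to_r})^*\subseteq\widetilde{\to_r^*}$.
   Context: Resource terms: $s::=x\mid\lambda x.s\mid\langle s\rangle\bar t$ with $\bar t$ a finite multiset of resource terms. A finite sum is a finite set of resource terms written additively ($0$ empty); constructors extend by linearity. Resource substitution $s\langle\bar t/x\rangle$ is the sum over all ways of replacing the free occurrences of $x$ in $s$ bijectively by the elements of $\bar t$ ($0$ if the counts differ). $\mapsto_r$ is the least relation with $\langle\lambda x.s\rangle\bar t\mapsto_r s\langle\bar t/x\rangle$ closed under: $s\mapsto_rS$ implies $\lambda x.s\mapsto_r\lambda x.S$, $\langle s\rangle\bar t\mapsto_r\langle S\rangle\bar t$, $s\cdot\bar t\mapsto_rS\cdot\bar t$; $\bar t\mapsto_r\bar T$ implies $\langle s\rangle\bar t\mapsto_r\langle s\rangle\bar T$. On finite sums: $\sum_{i=0}^ns_i\to_r\sum_{i=0}^nT_i$ whenever $s_0\mapsto_rT_0$ and for each $i\ge1$ either $s_i\mapsto_rT_i$ or $T_i=s_i$; $\to_r^*$ is the reflexive–transitive closure. For a relation $\to$ between elements of a set $X$ and finite subsets of $X$, $\widetilde{\to}$ is the relation on (possibly infinite) subsets of $X$ with $A\mathrel{\widetilde\to}B$ iff there are an index set $I$, elements $a_i\in X$ and finite sets $B_i$ ($i\in I$) with $A=\bigcup_{i\in I}\{a_i\}$, $B=\bigcup_{i\in I}B_i$ and $a_i\to B_i$ for all $i$. Here $\to_r$ and $\to_r^*$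 are regarded as relations from resource terms (one-element sums) to finite sums. -}

module Defs where

open import Data.Nat using (ℕ; zero; suc; _+_; _≡ᵇ_; _<ᵇ_; pred)
open import Data.Bool using (if_then_else_; true; false)
open import Data.List using (List; []; _∷_; [_]; map; concat; concatMap; _++_; length)
open import Data.List.Relation.Unary.Any using (Any)
open import Data.List.Relation.Binary.Pointwise using (Pointwise)
open import Data.Product using (Σ; _×_; _,_; proj₁; proj₂; ∃)
open import Function.Bundles using (_⇔_)

-- Resource terms (de Bruijn indices; bags are lists, identified up to
-- permutation by the equivalence _≈_ below).

data Term : Set where
  var : ℕ → Term
  lam : Term → Term
  app : Term → List Term → Term

Bag : Set
Bag = List Term

mutual
  data _≈_ : Term → Term → Set where
    ≈-refl  : ∀ {s} → s ≈ s
    ≈-sym   : ∀ {s t} → s ≈ t → t ≈ s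
    ≈-trans : ∀ {s t u} → s ≈ t → t ≈ u → s ≈ u
    ≈-lam   : ∀ {s t} → s ≈ t → lam s ≈ lam t
    ≈-app   : ∀ {s t ss ts} → s ≈ t → ss ≈b ts → app s ss ≈ app t ts

  data _≈b_ : Bag → Bag → Set where
    b-refl  : ∀ {ss} → ss ≈b ss
    b-sym   : ∀ {ss ts} → ss ≈b ts → ts ≈b ss
    b-trans : ∀ {ss ts us} → ss ≈b ts → ts ≈b us → ss ≈b us
    b-cons  : ∀ {s t ss ts} → s ≈ t → ss ≈b ts → (s ∷ ss) ≈b (t ∷ ts)
    b-swap  : ∀ {s t ss} → (s ∷ t ∷ ss) ≈b (t ∷ s ∷ ss)

-- Finite sums: finite sets of terms, represented by lists, read as sets
-- (up to ≈, with repetitions irrelevant).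

Sum : Set
Sum = List Term

_∈ₛ_ : Term → Sum → Set
x ∈ₛ S = Any (x ≈_) S

_≋_ : Sum → Sum → Set
S ≋ S' = ∀ x → (x ∈ₛ S) ⇔ (x ∈ₛ S')

mutual
  shift : ℕ → ℕ → Term → Term
  shift d c (var n) = if n <ᵇ c then var n else var (n + d)
  shift d c (lam s) = lam (shift d (suc c) s)
  shift d c (app s ts) = app (shift d c s) (shiftB d c ts)

  shiftB : ℕ → ℕ → Bag → Bag
  shiftB d c [] = []
  shiftB d c (t ∷ ts) = shift d c t ∷ shiftB d c ts

mutual
  occ : ℕ → Term → ℕ
  occ k (var n) = if n ≡ᵇ k then 1 else 0
  occ k (lam s) = occ (suc k) s
  occ k (app s ts) = occ k s + occB k ts

  occB : ℕ → Bag → ℕ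
  occB k [] = 0
  occB k (t ∷ ts) = occ k t + occB k ts

-- replace the occurrences of the variable (at depth k) in left-to-right
-- order by the successive elements of the list, removing the binder
-- (free indices above it are decremented); returns the unused elements.
mutual
  fill : ℕ → Term → List Term → Term × List Term
  fill k (var n) σ with n ≡ᵇ k | n <ᵇ k
  fill k (var n) [] | true | _ = var n , []
  fill k (var n) (t ∷ σ) | true | _ = shift k 0 t , σ
  fill k (var n) σ | false | true = var n , σ
  fill k (var n) σ | false | false = var (pred n) , σ
  fill k (lam s) σ with fill (suc k) s σ
  ... | s' , r = lam s' , r
  fill k (app s ts) σ with fill k s σ
  ... | s' , r with fillB k ts r
  ...   | ts' , r' = app s' ts' , r'

  fillB : ℕ → Bag → List Term → Bag × List Term
  fillB k [] σ = [] , σ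
  fillB k (t ∷ ts) σ with fill k t σ
  ... | t' , r with fillB k ts r
  ...   | ts' , r' = (t' ∷ ts') , r'

insertAll : {A : Set} → A → List A → List (List A)
insertAll x [] = [ [ x ] ]
insertAll x (y ∷ ys) = (x ∷ y ∷ ys) ∷ map (y ∷_) (insertAll x ys)

perms : {A : Set} → List A → List (List A)
perms [] = [ [] ]
perms (x ∷ xs) = concatMap (insertAll x) (perms xs)

-- s⟨t̄/x⟩ for x the variable bound by the removed λ: the sum over all
-- bijections between the occurrences of x and the elements of t̄
-- (0 if the numbers differ).
subst0 : Term → Bag → Sum
subst0 s ts =
  if occ 0 s ≡ᵇ length ts
  then map (λ σ → proj₁ (fill 0 s σ)) (perms ts)
  else []

mutual
  data _↦_ : Term → Sum → Set where
    β    : ∀ {s ts} → app (lam s) ts ↦ subst0 s ts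
    ξlam : ∀ {s S} → s ↦ S → lam s ↦ map lam S
    ξfun : ∀ {s S ts} → s ↦ S → app s ts ↦ map (λ u → app u ts) S
    ξarg : ∀ {s ts TS} → ts ↦b TS → app s ts ↦ map (app s) TS

  data _↦b_ : Bag → List Bag → Set where
    here  : ∀ {s S ts} → s ↦ S → (s ∷ ts) ↦b map (_∷ ts) S
    there : ∀ {t ts TS} → ts ↦b TS → (t ∷ ts) ↦b map (t ∷_) TS

data _↦?_ : Term → Sum → Set where
  red  : ∀ {s S} → s ↦ S → s ↦? S
  keep : ∀ {s} → s ↦? [ s ]

_⇒_ : Sum → Sum → Set
S ⇒ S' = Σ Term λ s₀ → Σ Sum λ T₀ → Σ (List Term) λ ss → Σ (List Sum) λ Ts →
  (s₀ ↦ T₀) × Pointwise _↦?_ ss Ts × (S ≋ (s₀ ∷ ss)) × (S' ≋ (T₀ ++ concat Ts))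

data _⇒*_ : Sum → Sum → Set where
  ε   : ∀ {S S'} → S ≋ S' → S ⇒* S'
  _◅_ : ∀ {S S' S''} → S ⇒ S' → S' ⇒* S'' → S ⇒* S''

_→r_ : Term → Sum → Set
a →r B = [ a ] ⇒ B

_→r*_ : Term → Sum → Set
a →r* B = [ a ] ⇒* B

record TSet : Set₁ where
  field
    elem   : Term → Set
    closed : ∀ {x y} → x ≈ y → elem x → elem y
open TSet public

_≐_ : TSet → TSet → Set
A ≐ B = ∀ x → elem A x ⇔ elem B x

Tilde : (Term → Sum → Set) → TSet → TSet → Set₁
Tilde R A B = Σ Set λ I → Σ (I → Term) λ a → Σ (I → Sum) λ Bs →
  (∀ x → elem A x ⇔ (∃ λ i → x ≈ a i)) ×
  (∀ x → elem B x ⇔ (∃ λ i → x ∈ₛ Bs i)) ×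
  (∀ i → R (a i) (Bs i))

data Star (R : TSet → TSet → Set₁) : TSet → TSet → Set₁ where
  ε   : ∀ {A B} → A ≐ B → Star R A B
  _◅_ : ∀ {A B C} → R A B → Star R B C → Star R A C

{-# OPTIONS --safe #-}
-- Both parts rest on one observation: if B →̃ᵣ* C, every finite sum S whose
-- terms lie in B reduces, by reducing its terms in parallel, to a finite sum
-- included in C.  Composing A →̃ᵣ* B with this gives reductions from the aᵢ
-- into C; the sums Cⱼ not reached this way are reached by reducing some aᵢ
-- whose sum contains bⱼ, since a finite sum is a set and so does not change
-- when bⱼ is added to it once more.  Part (2) then follows from (1), since
-- →̃ᵣ is contained in →̃ᵣ*.
module Submission where

open import Defs
open import Data.Product using (_×_; Σ; _,_; proj₁; proj₂)
import Data.Product as Product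
open import Data.Sum using (_⊎_; inj₁; inj₂; [_,_]′)
import Data.Sum as Sum
open import Data.List using ([]; _∷_; [_]; map; concat; _++_)
open import Data.List.Relation.Unary.Any using (here; there)
import Data.List.Relation.Unary.Any as Any
open import Data.List.Relation.Unary.Any.Properties using (++⁺ˡ; ++⁺ʳ; ++⁻; ++-comm)
open import Data.List.Relation.Binary.Pointwise using (Pointwise; []; _∷_)
  renaming (++⁺ to Pointwise-++⁺)
open import Data.List.Properties using (++-assoc; concat-++; concat-map-[_])
open import Function using (_∘_; id)
open import Function.Bundles using (mk⇔; Equivalence)
import Function.Properties.Equivalence as ⇔
open import Relation.Binary.PropositionalEquality using (_≡_; refl; cong; module ≡-Reasoning)
open ≡-Reasoning

open Equivalence using (to; from)

≋-refl : ∀ {S} → S ≋ S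
≋-refl x = ⇔.refl

≋-sym : ∀ {S R} → S ≋ R → R ≋ S
≋-sym e x = ⇔.sym (e x)

≋-trans : ∀ {S R T} → S ≋ R → R ≋ T → S ≋ T
≋-trans e f x = ⇔.trans (e x) (f x)

≋-reflexive : ∀ {S R} → S ≡ R → S ≋ R
≋-reflexive refl = ≋-refl

++⁺-≋ : ∀ {S S' R R'} → S ≋ S' → R ≋ R' → (S ++ R) ≋ (S' ++ R')
++⁺-≋ {S} {S'} e f x = mk⇔ (cong-++ S S' e f) (cong-++ S' S (≋-sym e) (≋-sym f))
  where
  cong-++ : ∀ S S' {R R'} → S ≋ S' → R ≋ R' → x ∈ₛ (S ++ R) → x ∈ₛ (S' ++ R')
  cong-++ S S' e f = [ ++⁺ˡ , ++⁺ʳ S' ]′ ∘ Sum.map (to (e x)) (to (f x)) ∘ ++⁻ S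

++-comm-≋ : ∀ S R → (S ++ R) ≋ (R ++ S)
++-comm-≋ S R x = mk⇔ (++-comm S R) (++-comm R S)

∷-absorb-≋ : ∀ {y S} → y ∈ₛ S → (y ∷ S) ≋ S
∷-absorb-≋ y∈S x = mk⇔ (λ { (here x≈y) → Any.map (≈-trans x≈y) y∈S ; (there p) → p }) there

[]-cong-≋ : ∀ {y z} → y ≈ z → [ y ] ≋ [ z ]
[]-cong-≋ y≈z x = mk⇔ (λ { (here x≈y) → here (≈-trans x≈y y≈z) })
                      (λ { (here x≈z) → here (≈-trans x≈z (≈-sym y≈z)) })

⇒*-respˡ-≋ : ∀ {S S' T} → S' ≋ S → S ⇒* T → S' ⇒* T
⇒*-respˡ-≋ e (ε f) = ε (≋-trans e f)
⇒*-respˡ-≋ e ((s₀ , T₀ , ss , Ts , r , rs , S≋ , T≋) ◅ st) =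
  (s₀ , T₀ , ss , Ts , r , rs , ≋-trans e S≋ , T≋) ◅ st

⇒*-respʳ-≋ : ∀ {S T T'} → T ≋ T' → S ⇒* T → S ⇒* T'
⇒*-respʳ-≋ e (ε f) = ε (≋-trans f e)
⇒*-respʳ-≋ e (s ◅ st) = s ◅ ⇒*-respʳ-≋ e st

⇒*-trans : ∀ {S T U} → S ⇒* T → T ⇒* U → S ⇒* U
⇒*-trans (ε f) st = ⇒*-respˡ-≋ f st
⇒*-trans (s ◅ st) st' = s ◅ ⇒*-trans st st'

keep-all : ∀ R → Pointwise _↦?_ R (map [_] R)
keep-all [] = []
keep-all (r ∷ R) = keep ∷ keep-all R

⇒-++ʳ : ∀ {S S'} R → S ⇒ S' → (S ++ R) ⇒ (S' ++ R)
⇒-++ʳ R (s₀ , T₀ , ss , Ts , r , rs , S≋ , S'≋) =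
  s₀ , T₀ , ss ++ R , Ts ++ map [_] R , r , Pointwise-++⁺ rs (keep-all R) ,
  ++⁺-≋ S≋ ≋-refl , ≋-trans (++⁺-≋ S'≋ ≋-refl) (≋-reflexive reassoc)
  where
  reassoc : (T₀ ++ concat Ts) ++ R ≡ T₀ ++ concat (Ts ++ map [_] R)
  reassoc = begin
    (T₀ ++ concat Ts) ++ R                 ≡⟨ ++-assoc T₀ (concat Ts) R ⟩
    T₀ ++ (concat Ts ++ R)                 ≡⟨ cong (λ X → T₀ ++ (concat Ts ++ X)) (concat-map-[ R ]) ⟨
    T₀ ++ (concat Ts ++ concat (map [_] R)) ≡⟨ cong (T₀ ++_) (concat-++ Ts (map [_] R)) ⟩
    T₀ ++ concat (Ts ++ map [_] R)         ∎

⇒*-++ʳ : ∀ {S S'} R → S ⇒* S' → (S ++ R) ⇒* (S' ++ R)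
⇒*-++ʳ R (ε f) = ε (++⁺-≋ f ≋-refl)
⇒*-++ʳ R (s ◅ st) = ⇒-++ʳ R s ◅ ⇒*-++ʳ R st

⇒*-++ : ∀ {S S' R R'} → S ⇒* S' → R ⇒* R' → (S ++ R) ⇒* (S' ++ R')
⇒*-++ {S} {S'} {R} {R'} S⇒*S' R⇒*R' =
  ⇒*-trans (⇒*-++ʳ R S⇒*S')
    (⇒*-respˡ-≋ (++-comm-≋ S' R) (⇒*-respʳ-≋ (++-comm-≋ R' S') (⇒*-++ʳ S' R⇒*R')))

_⊆ₜ_ : Sum → TSet → Set
S ⊆ₜ A = ∀ {x} → x ∈ₛ S → elem A x

record ReducesInto (S : Sum) (C : TSet) : Set where
  field
    target   : Sum
    reduces  : S ⇒* target
    target⊆C : target ⊆ₜ C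

reduceInto : ∀ {B C} → Tilde _→r*_ B C → ∀ S → S ⊆ₜ B → ReducesInto S C
reduceInto _ [] _ = record { target = [] ; reduces = ε ≋-refl ; target⊆C = λ () }
reduceInto {B} {C} t@(J , b , Cs , hB , hC , b→Cs) (y ∷ S) y∷S⊆B
  with to (hB y) (y∷S⊆B (here ≈-refl))
... | j , y≈bj = record
  { target   = Cs j ++ target rest
  ; reduces  = ⇒*-++ {S = [ y ]} (⇒*-respˡ-≋ ([]-cong-≋ y≈bj) (b→Cs j)) (reduces rest)
  ; target⊆C = [ (λ q → from (hC _) (j , q)) , target⊆C rest ]′ ∘ ++⁻ (Cs j)
  }
  where
  open ReducesInto
  rest : ReducesInto S C
  rest = reduceInto {B} {C} t S (y∷S⊆B ∘ there)

tilde-refl : (A : TSet) → Tilde _→r*_ A A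
tilde-refl A = Σ Term (elem A) , proj₁ , (λ i → [ proj₁ i ]) ,
  (λ x → mk⇔ (λ x∈A → (x , x∈A) , ≈-refl) (λ { ((y , y∈A) , x≈y) → closed A (≈-sym x≈y) y∈A })) ,
  (λ x → mk⇔ (λ x∈A → (x , x∈A) , here ≈-refl) (λ { ((y , y∈A) , here x≈y) → closed A (≈-sym x≈y) y∈A })) ,
  (λ _ → ε ≋-refl)

tilde-trans : (A B C : TSet) → Tilde _→r*_ A B → Tilde _→r*_ B C → Tilde _→r*_ A C
tilde-trans A B C (I , a , Bs , hA , hB , a→Bs) t@(J , b , Cs , hB' , hC , b→Cs) =
  (I ⊎ J) , a' , Cs' ,
  (λ x → mk⇔ (λ x∈A → Product.map inj₁ id (to (hA x) x∈A))
             (λ { (inj₁ i , x≈a) → from (hA x) (i , x≈a)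
                ; (inj₂ j , x≈a) → from (hA x) (iOf j , x≈a) })) ,
  (λ x → mk⇔ (λ x∈C → let (j , q) = to (hC x) x∈C in inj₂ j , ++⁺ˡ q)
             (λ { (inj₁ i , q) → target⊆C (into i) q
                ; (inj₂ j , q) → [ (λ q' → from (hC x) (j , q')) , target⊆C (into (iOf j)) ]′
                                   (++⁻ (Cs j) q) })) ,
  a'→Cs'
  where
  open ReducesInto
  into : ∀ i → ReducesInto (Bs i) C
  into i = reduceInto {B} {C} t (Bs i) (λ p → from (hB _) (i , p))
  bj∈Bs : ∀ j → Σ I λ i → b j ∈ₛ Bs i
  bj∈Bs j = to (hB (b j)) (from (hB' (b j)) (j , ≈-refl))
  iOf : J → I
  iOf j = proj₁ (bj∈Bs j)
  a' : I ⊎ J → Term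
  a' = [ a , a ∘ iOf ]′
  Cs' : I ⊎ J → Sum
  Cs' (inj₁ i) = target (into i)
  Cs' (inj₂ j) = Cs j ++ target (into (iOf j))
  a'→Cs' : ∀ k → a' k →r* Cs' k
  a'→Cs' (inj₁ i) = ⇒*-trans (a→Bs i) (reduces (into i))
  a'→Cs' (inj₂ j) = ⇒*-trans (a→Bs (iOf j))
    (⇒*-respˡ-≋ (≋-sym (∷-absorb-≋ (proj₂ (bj∈Bs j))))
      (⇒*-++ {S = [ b j ]} (b→Cs j) (reduces (into (iOf j)))))

Tilde-respʳ-≐ : ∀ {R A B B'} → Tilde R A B → B ≐ B' → Tilde R A B'
Tilde-respʳ-≐ (I , a , Bs , hA , hB , r) B≐B' =
  I , a , Bs , hA , (λ x → ⇔.trans (⇔.sym (B≐B' x)) (hB x)) , r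

→r⊆→r* : ∀ {a S} → a →r S → a →r* S
→r⊆→r* r = r ◅ ε ≋-refl

Tilde-map : ∀ {R R' A B} → (∀ {a S} → R a S → R' a S) → Tilde R A B → Tilde R' A B
Tilde-map f (I , a , Bs , hA , hB , r) = I , a , Bs , hA , hB , f ∘ r

star-tilde⊆tilde-star : (A B : TSet) → Star (Tilde _→r_) A B → Tilde _→r*_ A B
star-tilde⊆tilde-star A B (ε A≐B) = Tilde-respʳ-≐ {_→r*_} {A} {A} {B} (tilde-refl A) A≐B
star-tilde⊆tilde-star A C (_◅_ {B = B} s st) =
  tilde-trans A B C (Tilde-map {_→r_} {_→r*_} {A} {B} →r⊆→r* s) (star-tilde⊆tilde-star B C st)

lemma3p15 : ((A : TSet) → Tilde _→r*_ A A)
    × ((A B C : TSet) → Tilde _→r*_ A B → Tilde _→r*_ B C → Tilde _→r*_ A C)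
    × ((A B : TSet) → Star (Tilde _→r_) A B → Tilde _→r*_ A B)
lemma3p15 = tilde-refl , tilde-trans , star-tilde⊆tilde-star
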